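{- Let $\mathcal T$ be a theory (set of axioms) in first-order predicate logic and $A$ a formula. If $A$ is valid in all the $\mathcal B$-valued models of $\mathcal T$ (for arbitrary truth values algebras $\mathcal B$) in which the denotation of $A$ is defined, then $\mathcal T\vdash A$ in intuitionistic natural deduction.
   Context: Truth values algebra: a structure $\langle \mathcal B,\mathcal B^+,\mathcal A,\mathcal E,\tilde\top,\tilde\bot,\tilde\Rightarrow,\tilde\wedge,\tilde\vee,\tilde\forall,\tilde\exists\rangle$ with $\mathcal B$ a set, $\mathcal B^+\subseteq\mathcal B$, $\mathcal A,\mathcal E\subseteq\wp(\mathcal B)$, $\tilde\top,\tilde\bot\in\mathcal B$, $\tilde\Rightarrow,\tilde\wedge,\tilde\vee:\mathcal B\times\mathcal B\to\mathcal B$, $\tilde\forall:\mathcal A\to\mathcal B$, $\tilde\exists:\mathcal E\to\mathcal B$, such that for all $a,b,c\in\mathcal B$, $A\in\mathcal A$, $E\in\mathcal E$ ($\tilde\Rightarrow$ right-associative): (1) if $a\tilde\Rightarrow b\in\mathcal B^+$ and $a\in\mathcal B^+$ then $b\in\mathcal B^+$; (2) $a\tilde\Rightarrow b\tilde\Rightarrow a\in\mathcal B^+$; (3) $(a\tilde\Rightarrow b\tilde\Rightarrow c)\tilde\Rightarrow(a\tilde\Rightarrow b)\tilde\Rightarrow a\tilde\Rightarrow c\in\mathcal B^+$; (4) $\tilde\top\in\mathcal B^+$; (5) $\tilde\bot\tilde\Rightarrow a\in\mathcal B^+$; (6) $a\tilde\Rightarrow b\tilde\Rightarrow(a\tilde\wedge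 b)\in\mathcal B^+$; (7) $(a\tilde\wedge b)\tilde\Rightarrow a\in\mathcal B^+$; (8) $(a\tilde\wedge b)\tilde\Rightarrow b\in\mathcal B^+$; (9) $a\tilde\Rightarrow(a\tilde\vee b)\in\mathcal B^+$; (10) $b\tilde\Rightarrow(a\tilde\vee b)\in\mathcal B^+$; (11) $(a\tilde\vee b)\tilde\Rightarrow(a\tilde\Rightarrow c)\tilde\Rightarrow(b\tilde\Rightarrow c)\tilde\Rightarrow c\in\mathcal B^+$; (12) $\{a\tilde\Rightarrow e\mid e\in A\}\in\mathcal A$ and $\{e\tilde\Rightarrow a\mid e\in E\}\in\mathcal A$; (13) if $A\subseteq\mathcal B^+$ then $\tilde\forall A\in\mathcal B^+$; (14) $\tilde\forall\{a\tilde\Rightarrow e\mid e\in A\}\tilde\Rightarrow a\tilde\Rightarrow\tilde\forall A\in\mathcal B^+$; (15) if $a\in A$ then $(\tilde\forall A)\tilde\Rightarrow a\in\mathcal B^+$; (16) if $a\in E$ then $a\tilde\Rightarrow\tilde\exists E\in\mathcal B^+$; (17) $(\tilde\exists E)\tilde\Rightarrow\tilde\forall\{e\tilde\Rightarrow a\mid e\in E\}\tilde\Rightarrow a\in\mathcal B^+$. Models: a $\mathcal B$-valued structure has a domain $\mathcal M$, $\hat f:\mathcal M^n\to\mathcal M$ for function symbols, $\hat P:\mathcal M^n\to\mathcal B$ for predicate symbols; denotation $\llbracket\cdot\rrbracket_\phi$ under an assignment $\phi$ is compositional, with $\top,\bot,\Rightarrow,\wedge,\vee$ interpreted by $\tilde\top,\tilde\bot,\tilde\Rightarrow,\tilde\wedge,\tilde\vee$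 and $\llbracket\forall x A\rrbracket_\phi=\tilde\forall\{\llbracket A\rrbracket_{\phi+\langle x,e\rangle}\mid e\in\mathcal M\}$, $\llbracket\exists x A\rrbracket_\phi=\tilde\exists\{\llbracket A\rrbracket_{\phi+\langle x,e\rangle}\mid e\in\mathcal M\}$ (undefined when the set is not in $\mathcal A$, resp. $\mathcal E$). A formula is valid in the structure if under every assignment its denotation is defined and in $\mathcal B^+$; the structure is a model of $\mathcal T$ if all axioms of $\mathcal T$ are valid in it. -}

module Defs where

open import Data.Nat using (ℕ; zero; suc; _<_)
open import Data.Vec using (Vec; []; _∷_)
open import Data.List using (List; []; _∷_; map)
open import Data.List.Membership.Propositional using (_∈_)
open import Data.List.Relation.Unary.All as ListAll using ()
open import Data.Vec.Relation.Unary.All as VecAll using ()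
open import Data.Product using (Σ; _×_; _,_)
open import Relation.Binary.Structures using (IsEquivalence)

-- First-order signatures (no built-in equality)

record Signature : Set₁ where
  field
    FunSym     : Set
    PredSym    : Set
    funArity   : FunSym → ℕ
    predArity  : PredSym → ℕ
open Signature public

data Term (S : Signature) : Set where
  var : ℕ → Term S
  app : (f : FunSym S) → Vec (Term S) (funArity S f) → Term S

data Formula (S : Signature) : Set where
  atom     : (P : PredSym S) → Vec (Term S) (predArity S P) → Formula S
  ⊤′ ⊥′    : Formula S
  _⇒′_ _∧′_ _∨′_ : Formula S → Formula S → Formula S
  ∀′ ∃′    : Formula S → Formula S   -- binds de Bruijn index 0

infixr 5 _⇒′_
infixr 6 _∨′_
infixr 7 _∧′_

module _ {S : Signature} where

  mutual
    renT : (ℕ → ℕ) → Term S → Term S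
    renT ρ (var x)    = var (ρ x)
    renT ρ (app f ts) = app f (renTs ρ ts)

    renTs : ∀ {n} → (ℕ → ℕ) → Vec (Term S) n → Vec (Term S) n
    renTs ρ []       = []
    renTs ρ (t ∷ ts) = renT ρ t ∷ renTs ρ ts

  liftR : (ℕ → ℕ) → ℕ → ℕ
  liftR ρ zero    = zero
  liftR ρ (suc x) = suc (ρ x)

  renF : (ℕ → ℕ) → Formula S → Formula S
  renF ρ (atom P ts) = atom P (renTs ρ ts)
  renF ρ ⊤′          = ⊤′
  renF ρ ⊥′          = ⊥′
  renF ρ (A ⇒′ B)    = renF ρ A ⇒′ renF ρ B
  renF ρ (A ∧′ B)    = renF ρ A ∧′ renF ρ B
  renF ρ (A ∨′ B)    = renF ρ A ∨′ renF ρ B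
  renF ρ (∀′ A)      = ∀′ (renF (liftR ρ) A)
  renF ρ (∃′ A)      = ∃′ (renF (liftR ρ) A)

  shift : Formula S → Formula S
  shift = renF suc

  shiftT : Term S → Term S
  shiftT = renT suc

  mutual
    subT : (ℕ → Term S) → Term S → Term S
    subT σ (var x)    = σ x
    subT σ (app f ts) = app f (subTs σ ts)

    subTs : ∀ {n} → (ℕ → Term S) → Vec (Term S) n → Vec (Term S) n
    subTs σ []       = []
    subTs σ (t ∷ ts) = subT σ t ∷ subTs σ ts

  liftS : (ℕ → Term S) → ℕ → Term S
  liftS σ zero    = var zero
  liftS σ (suc x) = shiftT (σ x)

  subF : (ℕ → Term S) → Formula S → Formula S
  subF σ (atom P ts) = atom P (subTs σ ts)
  subF σ ⊤′          = ⊤′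
  subF σ ⊥′          = ⊥′
  subF σ (A ⇒′ B)    = subF σ A ⇒′ subF σ B
  subF σ (A ∧′ B)    = subF σ A ∧′ subF σ B
  subF σ (A ∨′ B)    = subF σ A ∨′ subF σ B
  subF σ (∀′ A)      = ∀′ (subF (liftS σ) A)
  subF σ (∃′ A)      = ∃′ (subF (liftS σ) A)

  σ₀ : Term S → ℕ → Term S
  σ₀ t zero    = t
  σ₀ t (suc x) = var x

  _[_] : Formula S → Term S → Formula S
  A [ t ] = subF (σ₀ t) A

  data WfT (n : ℕ) : Term S → Set where
    var : ∀ {x} → x < n → WfT n (var x)
    app : ∀ {f ts} → VecAll.All (WfT n) ts → WfT n (app f ts)

  data WfF : ℕ → Formula S → Set where
    atom : ∀ {n P ts} → VecAll.All (WfT n) ts → WfF n (atom P ts)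
    ⊤′   : ∀ {n} → WfF n ⊤′
    ⊥′   : ∀ {n} → WfF n ⊥′
    _⇒′_ : ∀ {n A B} → WfF n A → WfF n B → WfF n (A ⇒′ B)
    _∧′_ : ∀ {n A B} → WfF n A → WfF n B → WfF n (A ∧′ B)
    _∨′_ : ∀ {n A B} → WfF n A → WfF n B → WfF n (A ∨′ B)
    ∀′   : ∀ {n A} → WfF (suc n) A → WfF n (∀′ A)
    ∃′   : ∀ {n A} → WfF (suc n) A → WfF n (∃′ A)

  Closed : Formula S → Set
  Closed = WfF 0

  infix 3 _⊢_
  data _⊢_ (Γ : List (Formula S)) : Formula S → Set where
    ax   : ∀ {A} → A ∈ Γ → Γ ⊢ A
    ⊤I   : Γ ⊢ ⊤′
    ⊥E   : ∀ {A} → Γ ⊢ ⊥′ → Γ ⊢ A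
    ⇒I   : ∀ {A B} → A ∷ Γ ⊢ B → Γ ⊢ A ⇒′ B
    ⇒E   : ∀ {A B} → Γ ⊢ A ⇒′ B → Γ ⊢ A → Γ ⊢ B
    ∧I   : ∀ {A B} → Γ ⊢ A → Γ ⊢ B → Γ ⊢ A ∧′ B
    ∧E₁  : ∀ {A B} → Γ ⊢ A ∧′ B → Γ ⊢ A
    ∧E₂  : ∀ {A B} → Γ ⊢ A ∧′ B → Γ ⊢ B
    ∨I₁  : ∀ {A B} → Γ ⊢ A → Γ ⊢ A ∨′ B
    ∨I₂  : ∀ {A B} → Γ ⊢ B → Γ ⊢ A ∨′ B
    ∨E   : ∀ {A B C} → Γ ⊢ A ∨′ B → A ∷ Γ ⊢ C → B ∷ Γ ⊢ C → Γ ⊢ C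
    -- ∀-intro: the bound variable (index 0) is fresh for Γ
    ∀I   : ∀ {A} → map shift Γ ⊢ A → Γ ⊢ ∀′ A
    ∀E   : ∀ {A} → Γ ⊢ ∀′ A → (t : Term S) → Γ ⊢ A [ t ]
    ∃I   : ∀ {A} (t : Term S) → Γ ⊢ A [ t ] → Γ ⊢ ∃′ A
    ∃E   : ∀ {A C} → Γ ⊢ ∃′ A → A ∷ map shift Γ ⊢ shift C → Γ ⊢ C

  -- 𝒯 ⊢ A : A is derivable from finitely many axioms of 𝒯
  infix 3 _⊩_
  _⊩_ : (Formula S → Set) → Formula S → Set
  𝒯 ⊩ A = Σ (List (Formula S)) λ Γ → ListAll.All 𝒯 Γ × (Γ ⊢ A)

-- Truth values algebras.
-- The carrier is a setoid (B, ≈); subsets of B are predicates B → Set,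
-- and set-theoretic extensionality is imposed on 𝒜, 𝓔, ∀̃, ∃̃.

Subset : Set → Set₁
Subset B = B → Set

record TVA : Set₁ where
  infixr 5 _⇒̃_
  infixr 6 _∨̃_
  infixr 7 _∧̃_
  field
    B     : Set
    _≈_   : B → B → Set
    ≈-equiv : IsEquivalence _≈_
    B⁺    : Subset B
    𝒜 𝓔  : Subset B → Set
    ⊤̃ ⊥̃  : B
    _⇒̃_ _∧̃_ _∨̃_ : B → B → B
    ∀̃     : (A : Subset B) → 𝒜 A → B
    ∃̃     : (E : Subset B) → 𝓔 E → B

    B⁺-resp : ∀ {a b} → a ≈ b → B⁺ a → B⁺ b
    ⇒̃-cong  : ∀ {a a′ b b′} → a ≈ a′ → b ≈ b′ → (a ⇒̃ b) ≈ (a′ ⇒̃ b′)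
    ∧̃-cong  : ∀ {a a′ b b′} → a ≈ a′ → b ≈ b′ → (a ∧̃ b) ≈ (a′ ∧̃ b′)
    ∨̃-cong  : ∀ {a a′ b b′} → a ≈ a′ → b ≈ b′ → (a ∨̃ b) ≈ (a′ ∨̃ b′)
    𝒜-ext   : ∀ {A A′} → (∀ b → A b → A′ b) → (∀ b → A′ b → A b) → 𝒜 A → 𝒜 A′
    𝓔-ext   : ∀ {E E′} → (∀ b → E b → E′ b) → (∀ b → E′ b → E b) → 𝓔 E → 𝓔 E′
    ∀̃-ext   : ∀ {A A′} → (∀ b → A b → A′ b) → (∀ b → A′ b → A b) →
              (p : 𝒜 A) (p′ : 𝒜 A′) → ∀̃ A p ≈ ∀̃ A′ p′
    ∃̃-ext   : ∀ {E E′} → (∀ b → E b → E′ b) → (∀ b → E′ b → E b) →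
              (p : 𝓔 E) (p′ : 𝓔 E′) → ∃̃ E p ≈ ∃̃ E′ p′

  _⇒̃set_ : B → Subset B → Subset B
  (a ⇒̃set A) b = Σ B λ e → A e × (b ≈ (a ⇒̃ e))

  _set⇒̃_ : Subset B → B → Subset B
  (E set⇒̃ a) b = Σ B λ e → E e × (b ≈ (e ⇒̃ a))

  field
    ax1  : ∀ {a b} → B⁺ (a ⇒̃ b) → B⁺ a → B⁺ b
    ax2  : ∀ a b → B⁺ (a ⇒̃ b ⇒̃ a)
    ax3  : ∀ a b c → B⁺ ((a ⇒̃ b ⇒̃ c) ⇒̃ (a ⇒̃ b) ⇒̃ a ⇒̃ c)
    ax4  : B⁺ ⊤̃
    ax5  : ∀ a → B⁺ (⊥̃ ⇒̃ a)
    ax6  : ∀ a b → B⁺ (a ⇒̃ b ⇒̃ (a ∧̃ b))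
    ax7  : ∀ a b → B⁺ ((a ∧̃ b) ⇒̃ a)
    ax8  : ∀ a b → B⁺ ((a ∧̃ b) ⇒̃ b)
    ax9  : ∀ a b → B⁺ (a ⇒̃ (a ∨̃ b))
    ax10 : ∀ a b → B⁺ (b ⇒̃ (a ∨̃ b))
    ax11 : ∀ a b c → B⁺ ((a ∨̃ b) ⇒̃ (a ⇒̃ c) ⇒̃ (b ⇒̃ c) ⇒̃ c)
    ax12a : ∀ a A → 𝒜 A → 𝒜 (a ⇒̃set A)
    ax12b : ∀ a E → 𝓔 E → 𝒜 (E set⇒̃ a)
    ax13 : ∀ A (p : 𝒜 A) → (∀ e → A e → B⁺ e) → B⁺ (∀̃ A p)
    ax14 : ∀ a A (p : 𝒜 A) →
           B⁺ (∀̃ (a ⇒̃set A) (ax12a a A p) ⇒̃ a ⇒̃ ∀̃ A p)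
    ax15 : ∀ a A (p : 𝒜 A) → A a → B⁺ (∀̃ A p ⇒̃ a)
    ax16 : ∀ a E (q : 𝓔 E) → E a → B⁺ (a ⇒̃ ∃̃ E q)
    ax17 : ∀ a E (q : 𝓔 E) →
           B⁺ (∃̃ E q ⇒̃ ∀̃ (E set⇒̃ a) (ax12b a E q) ⇒̃ a)

record Structure (S : Signature) (𝔅 : TVA) : Set₁ where
  open TVA 𝔅
  field
    M     : Set
    funI  : (f : FunSym S) → Vec M (funArity S f) → M
    predI : (P : PredSym S) → Vec M (predArity S P) → B

module Semantics {S : Signature} {𝔅 : TVA} (𝕄 : Structure S 𝔅) where
  open TVA 𝔅
  open Structure 𝕄

  Assignment : Set
  Assignment = ℕ → M

  _▷_ : Assignment → M → Assignment
  (φ ▷ e) zero    = e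
  (φ ▷ e) (suc x) = φ x

  mutual
    ⟦_⟧t : Term S → Assignment → M
    ⟦ var x ⟧t φ    = φ x
    ⟦ app f ts ⟧t φ = funI f (⟦ ts ⟧ts φ)

    ⟦_⟧ts : ∀ {n} → Vec (Term S) n → Assignment → Vec M n
    ⟦ [] ⟧ts φ     = []
    ⟦ t ∷ ts ⟧ts φ = ⟦ t ⟧t φ ∷ ⟦ ts ⟧ts φ

  Img : (M → B) → Subset B
  Img f b = Σ M λ e → b ≈ f e

  -- Den φ A b : "⟦A⟧_φ is defined and equals b"
  data Den (φ : Assignment) : Formula S → B → Set where
    atom : ∀ P ts → Den φ (atom P ts) (predI P (⟦ ts ⟧ts φ))
    ⊤′   : Den φ ⊤′ ⊤̃
    ⊥′   : Den φ ⊥′ ⊥̃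
    _⇒′_ : ∀ {A C a c} → Den φ A a → Den φ C c → Den φ (A ⇒′ C) (a ⇒̃ c)
    _∧′_ : ∀ {A C a c} → Den φ A a → Den φ C c → Den φ (A ∧′ C) (a ∧̃ c)
    _∨′_ : ∀ {A C a c} → Den φ A a → Den φ C c → Den φ (A ∨′ C) (a ∨̃ c)
    ∀′   : ∀ {A} (f : M → B) → (∀ e → Den (φ ▷ e) A (f e)) →
           (p : 𝒜 (Img f)) → Den φ (∀′ A) (∀̃ (Img f) p)
    ∃′   : ∀ {A} (f : M → B) → (∀ e → Den (φ ▷ e) A (f e)) →
           (q : 𝓔 (Img f)) → Den φ (∃′ A) (∃̃ (Img f) q)

  DefinedEverywhere : Formula S → Set
  DefinedEverywhere A = ∀ φ → Σ B λ b → Den φ A b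

  Valid : Formula S → Set
  Valid A = ∀ φ → Σ B λ b → Den φ A b × B⁺ b

  IsModelOf : (Formula S → Set) → Set
  IsModelOf 𝒯 = ∀ A → 𝒯 A → Valid A

-- Build a model from the syntax of 𝒯 itself. The truth values are the formulas, a formula
-- is positive when every substitution instance of it is derivable from 𝒯, and two formulas
-- are equal when each implies the other positively. A set of formulas is admissible for ∀̃
-- and ∃̃ when, up to this equality, it is the set of instances F [ t ] of a single formula F,
-- and then ∀̃ and ∃̃ give ∀′ F and ∃′ F; the algebra axioms become derivable schemes, the
-- quantifier ones proved by instantiating F at a variable fresh for everything in sight.
-- Over the domain of terms the denotation of A under φ is the instance subF φ A, so a
-- formula valid in this model is derivable.

module Submission where

open import Defs
open import Data.Nat using (ℕ; zero; suc; _<_; _≤_; _⊔_; s≤s)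
open import Data.Nat.Properties using (≤-trans; ≤-refl; m≤m⊔n; m≤n⊔m; n≤1+n; _≟_; <-irrefl)
open import Data.Vec using (Vec; []; _∷_)
open import Data.Vec.Relation.Unary.All as VecAll using ()
open import Data.List using ([]; _∷_; map; _++_)
open import Data.List.Relation.Unary.Any using (here; there)
open import Data.List.Relation.Unary.All using (All; []; _∷_)
open import Data.List.Relation.Unary.All.Properties using (++⁺)
open import Data.List.Relation.Binary.Subset.Propositional using (_⊆_)
open import Data.List.Relation.Binary.Subset.Propositional.Properties
  using (map⁺; ∷⁺ʳ; xs⊆xs++ys; xs⊆ys++xs)
open import Data.Product using (Σ; _×_; _,_; proj₁; proj₂)
open import Data.Empty using (⊥-elim)
open import Relation.Binary.Structures using (IsEquivalence)
open import Relation.Binary.PropositionalEquality hiding ([_])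
open import Relation.Nullary using (yes; no)

module _ {S : Signature} where

  Subst : Set
  Subst = ℕ → Term S

  _⨾_ : Subst → Subst → Subst
  (σ ⨾ τ) x = subT τ (σ x)

  renS : (ℕ → ℕ) → Subst
  renS ρ x = var (ρ x)

  _∷ₛ_ : Term S → Subst → Subst
  (t ∷ₛ σ) zero    = t
  (t ∷ₛ σ) (suc x) = σ x

  Agree : ℕ → Subst → Subst → Set
  Agree n σ τ = ∀ x → x < n → σ x ≡ τ x

  mutual
    subT-comp : ∀ σ τ t → subT τ (subT σ t) ≡ subT (σ ⨾ τ) t
    subT-comp σ τ (var x)    = refl
    subT-comp σ τ (app f ts) = cong (app f) (subTs-comp σ τ ts)

    subTs-comp : ∀ {n} σ τ (ts : Vec (Term S) n) → subTs τ (subTs σ ts) ≡ subTs (σ ⨾ τ) ts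
    subTs-comp σ τ []       = refl
    subTs-comp σ τ (t ∷ ts) = cong₂ _∷_ (subT-comp σ τ t) (subTs-comp σ τ ts)

  mutual
    subT-var : ∀ t → subT var t ≡ t
    subT-var (var x)    = refl
    subT-var (app f ts) = cong (app f) (subTs-var ts)

    subTs-var : ∀ {n} (ts : Vec (Term S) n) → subTs var ts ≡ ts
    subTs-var []       = refl
    subTs-var (t ∷ ts) = cong₂ _∷_ (subT-var t) (subTs-var ts)

  mutual
    renT≡subT : ∀ ρ t → renT ρ t ≡ subT (renS ρ) t
    renT≡subT ρ (var x)    = refl
    renT≡subT ρ (app f ts) = cong (app f) (renTs≡subTs ρ ts)

    renTs≡subTs : ∀ {n} ρ (ts : Vec (Term S) n) → renTs ρ ts ≡ subTs (renS ρ) ts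
    renTs≡subTs ρ []       = refl
    renTs≡subTs ρ (t ∷ ts) = cong₂ _∷_ (renT≡subT ρ t) (renTs≡subTs ρ ts)

  mutual
    subT-liftS-shiftT : ∀ σ t → subT (liftS σ) (shiftT t) ≡ shiftT (subT σ t)
    subT-liftS-shiftT σ (var x)    = refl
    subT-liftS-shiftT σ (app f ts) = cong (app f) (subTs-liftS-shiftTs σ ts)

    subTs-liftS-shiftTs : ∀ {n} σ (ts : Vec (Term S) n) →
                          subTs (liftS σ) (renTs suc ts) ≡ renTs suc (subTs σ ts)
    subTs-liftS-shiftTs σ []       = refl
    subTs-liftS-shiftTs σ (t ∷ ts) = cong₂ _∷_ (subT-liftS-shiftT σ t) (subTs-liftS-shiftTs σ ts)

  mutual
    subT-agree : ∀ {n σ τ t} → WfT n t → Agree n σ τ → subT σ t ≡ subT τ t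
    subT-agree (var {x} x<n) σ≐τ = σ≐τ x x<n
    subT-agree (app ws)      σ≐τ = cong (app _) (subTs-agree ws σ≐τ)

    subTs-agree : ∀ {n σ τ m} {ts : Vec (Term S) m} →
                  VecAll.All (WfT n) ts → Agree n σ τ → subTs σ ts ≡ subTs τ ts
    subTs-agree VecAll.[]       σ≐τ = refl
    subTs-agree (w VecAll.∷ ws) σ≐τ = cong₂ _∷_ (subT-agree w σ≐τ) (subTs-agree ws σ≐τ)

  shiftT-inst : ∀ u t → subT (σ₀ u) (shiftT t) ≡ t
  shiftT-inst u t = begin
    subT (σ₀ u) (shiftT t)            ≡⟨ cong (subT (σ₀ u)) (renT≡subT suc t) ⟩
    subT (σ₀ u) (subT (renS suc) t)   ≡⟨ subT-comp (renS suc) (σ₀ u) t ⟩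
    subT var t                        ≡⟨ subT-var t ⟩
    t                                 ∎
    where open ≡-Reasoning

  mutual
    wfT-weaken : ∀ {m n t} → m ≤ n → WfT m t → WfT n t
    wfT-weaken m≤n (var x<m) = var (≤-trans x<m m≤n)
    wfT-weaken m≤n (app ws)  = app (wfTs-weaken m≤n ws)

    wfTs-weaken : ∀ {m n k} {ts : Vec (Term S) k} →
                  m ≤ n → VecAll.All (WfT m) ts → VecAll.All (WfT n) ts
    wfTs-weaken m≤n VecAll.[]       = VecAll.[]
    wfTs-weaken m≤n (w VecAll.∷ ws) = wfT-weaken m≤n w VecAll.∷ wfTs-weaken m≤n ws

  mutual
    boundT : (t : Term S) → Σ ℕ λ n → WfT n t
    boundT (var x)    = suc x , var ≤-refl
    boundT (app f ts) = let n , ws = boundTs ts in n , app ws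

    boundTs : ∀ {k} (ts : Vec (Term S) k) → Σ ℕ λ n → VecAll.All (WfT n) ts
    boundTs []       = 0 , VecAll.[]
    boundTs (t ∷ ts) =
      let m , w = boundT t ; n , ws = boundTs ts
      in m ⊔ n , wfT-weaken (m≤m⊔n m n) w VecAll.∷ wfTs-weaken (m≤n⊔m m n) ws

  wfF-weaken : ∀ {m n F} → m ≤ n → WfF m F → WfF n F
  wfF-weaken m≤n (atom ws) = atom (wfTs-weaken m≤n ws)
  wfF-weaken m≤n ⊤′        = ⊤′
  wfF-weaken m≤n ⊥′        = ⊥′
  wfF-weaken m≤n (v ⇒′ w)  = wfF-weaken m≤n v ⇒′ wfF-weaken m≤n w
  wfF-weaken m≤n (v ∧′ w)  = wfF-weaken m≤n v ∧′ wfF-weaken m≤n w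
  wfF-weaken m≤n (v ∨′ w)  = wfF-weaken m≤n v ∨′ wfF-weaken m≤n w
  wfF-weaken m≤n (∀′ w)    = ∀′ (wfF-weaken (s≤s m≤n) w)
  wfF-weaken m≤n (∃′ w)    = ∃′ (wfF-weaken (s≤s m≤n) w)

  private
    bound₂ : ∀ {A B C : Formula S} → (∀ {n} → WfF n A → WfF n B → WfF n C) →
             Σ ℕ (λ n → WfF n A) → Σ ℕ (λ n → WfF n B) → Σ ℕ λ n → WfF n C
    bound₂ c (m , v) (n , w) = m ⊔ n , c (wfF-weaken (m≤m⊔n m n) v) (wfF-weaken (m≤n⊔m m n) w)

  boundF : (F : Formula S) → Σ ℕ λ n → WfF n F
  boundF (atom P ts) = let n , ws = boundTs ts in n , atom ws
  boundF ⊤′          = 0 , ⊤′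
  boundF ⊥′          = 0 , ⊥′
  boundF (A ⇒′ B)    = bound₂ _⇒′_ (boundF A) (boundF B)
  boundF (A ∧′ B)    = bound₂ _∧′_ (boundF A) (boundF B)
  boundF (A ∨′ B)    = bound₂ _∨′_ (boundF A) (boundF B)
  boundF (∀′ A)      = let n , w = boundF A in n , ∀′ (wfF-weaken (n≤1+n n) w)
  boundF (∃′ A)      = let n , w = boundF A in n , ∃′ (wfF-weaken (n≤1+n n) w)

  fresh : (F : Formula S) → Σ ℕ λ n → WfF (suc n) F
  fresh F = let n , w = boundF F in n , wfF-weaken (n≤1+n n) w

  liftS-agree : ∀ {n σ τ} → Agree n σ τ → Agree (suc n) (liftS σ) (liftS τ)
  liftS-agree σ≐τ zero    _         = refl
  liftS-agree σ≐τ (suc x) (s≤s x<n) = cong shiftT (σ≐τ x x<n)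

  subF-agree : ∀ {n σ τ F} → WfF n F → Agree n σ τ → subF σ F ≡ subF τ F
  subF-agree (atom ws) σ≐τ = cong (atom _) (subTs-agree ws σ≐τ)
  subF-agree ⊤′        σ≐τ = refl
  subF-agree ⊥′        σ≐τ = refl
  subF-agree (v ⇒′ w)  σ≐τ = cong₂ _⇒′_ (subF-agree v σ≐τ) (subF-agree w σ≐τ)
  subF-agree (v ∧′ w)  σ≐τ = cong₂ _∧′_ (subF-agree v σ≐τ) (subF-agree w σ≐τ)
  subF-agree (v ∨′ w)  σ≐τ = cong₂ _∨′_ (subF-agree v σ≐τ) (subF-agree w σ≐τ)
  subF-agree (∀′ w)    σ≐τ = cong ∀′ (subF-agree w (liftS-agree σ≐τ))
  subF-agree (∃′ w)    σ≐τ = cong ∃′ (subF-agree w (liftS-agree σ≐τ))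

  subF-cong : ∀ {σ τ} → σ ≗ τ → ∀ F → subF σ F ≡ subF τ F
  subF-cong σ≗τ F = subF-agree (proj₂ (boundF F)) (λ x _ → σ≗τ x)

  liftS-comp : ∀ σ τ → (liftS σ ⨾ liftS τ) ≗ liftS (σ ⨾ τ)
  liftS-comp σ τ zero    = refl
  liftS-comp σ τ (suc x) = subT-liftS-shiftT τ (σ x)

  subF-comp : ∀ σ τ F → subF τ (subF σ F) ≡ subF (σ ⨾ τ) F
  subF-comp σ τ (atom P ts) = cong (atom P) (subTs-comp σ τ ts)
  subF-comp σ τ ⊤′          = refl
  subF-comp σ τ ⊥′          = refl
  subF-comp σ τ (A ⇒′ B)    = cong₂ _⇒′_ (subF-comp σ τ A) (subF-comp σ τ B)
  subF-comp σ τ (A ∧′ B)    = cong₂ _∧′_ (subF-comp σ τ A) (subF-comp σ τ B)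
  subF-comp σ τ (A ∨′ B)    = cong₂ _∨′_ (subF-comp σ τ A) (subF-comp σ τ B)
  subF-comp σ τ (∀′ A)      =
    cong ∀′ (trans (subF-comp (liftS σ) (liftS τ) A) (subF-cong (liftS-comp σ τ) A))
  subF-comp σ τ (∃′ A)      =
    cong ∃′ (trans (subF-comp (liftS σ) (liftS τ) A) (subF-cong (liftS-comp σ τ) A))

  liftS-var : liftS var ≗ var {S}
  liftS-var zero    = refl
  liftS-var (suc x) = refl

  subF-var : ∀ F → subF var F ≡ F
  subF-var (atom P ts) = cong (atom P) (subTs-var ts)
  subF-var ⊤′          = refl
  subF-var ⊥′          = refl
  subF-var (A ⇒′ B)    = cong₂ _⇒′_ (subF-var A) (subF-var B)
  subF-var (A ∧′ B)    = cong₂ _∧′_ (subF-var A) (subF-var B)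
  subF-var (A ∨′ B)    = cong₂ _∨′_ (subF-var A) (subF-var B)
  subF-var (∀′ A)      = cong ∀′ (trans (subF-cong liftS-var A) (subF-var A))
  subF-var (∃′ A)      = cong ∃′ (trans (subF-cong liftS-var A) (subF-var A))

  liftS-renS : ∀ ρ → liftS (renS ρ) ≗ renS (liftR {S} ρ)
  liftS-renS ρ zero    = refl
  liftS-renS ρ (suc x) = refl

  renF≡subF : ∀ ρ F → renF ρ F ≡ subF (renS ρ) F
  renF≡subF ρ (atom P ts) = cong (atom P) (renTs≡subTs ρ ts)
  renF≡subF ρ ⊤′          = refl
  renF≡subF ρ ⊥′          = refl
  renF≡subF ρ (A ⇒′ B)    = cong₂ _⇒′_ (renF≡subF ρ A) (renF≡subF ρ B)
  renF≡subF ρ (A ∧′ B)    = cong₂ _∧′_ (renF≡subF ρ A) (renF≡subF ρ B)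
  renF≡subF ρ (A ∨′ B)    = cong₂ _∨′_ (renF≡subF ρ A) (renF≡subF ρ B)
  renF≡subF ρ (∀′ A)      =
    cong ∀′ (trans (renF≡subF (liftR {S} ρ) A) (sym (subF-cong (liftS-renS ρ) A)))
  renF≡subF ρ (∃′ A)      =
    cong ∃′ (trans (renF≡subF (liftR {S} ρ) A) (sym (subF-cong (liftS-renS ρ) A)))

  subF-closed : ∀ {σ C} → Closed C → subF σ C ≡ C
  subF-closed {C = C} w = trans (subF-agree w (λ _ ())) (subF-var C)

  shift-closed : ∀ {C} → Closed C → shift C ≡ C
  shift-closed {C} w = trans (renF≡subF suc C) (subF-closed w)

  shift-inst : ∀ A t → shift A [ t ] ≡ A
  shift-inst A t = begin
    subF (σ₀ t) (renF suc A)            ≡⟨ cong (subF (σ₀ t)) (renF≡subF suc A) ⟩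
    subF (σ₀ t) (subF (renS suc) A)     ≡⟨ subF-comp (renS suc) (σ₀ t) A ⟩
    subF var A                          ≡⟨ subF-var A ⟩
    A                                   ∎
    where open ≡-Reasoning

  shift↑-inst-var₀ : ∀ A → renF (liftR {S} suc) A [ var 0 ] ≡ A
  shift↑-inst-var₀ A = begin
    subF (σ₀ (var 0)) (renF ρ A)          ≡⟨ cong (subF (σ₀ (var 0))) (renF≡subF ρ A) ⟩
    subF (σ₀ (var 0)) (subF (renS ρ) A)   ≡⟨ subF-comp (renS ρ) (σ₀ (var 0)) A ⟩
    subF (renS ρ ⨾ σ₀ (var 0)) A          ≡⟨ subF-cong collapse A ⟩
    subF var A                            ≡⟨ subF-var A ⟩
    A                                     ∎
    where
    open ≡-Reasoning
    ρ = liftR {S} suc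
    collapse : renS ρ ⨾ σ₀ (var 0) ≗ var
    collapse zero    = refl
    collapse (suc x) = refl

  subF-liftS-shift : ∀ σ A → subF (liftS σ) (shift A) ≡ shift (subF σ A)
  subF-liftS-shift σ A = begin
    subF (liftS σ) (renF suc A)          ≡⟨ cong (subF (liftS σ)) (renF≡subF suc A) ⟩
    subF (liftS σ) (subF (renS suc) A)   ≡⟨ subF-comp (renS suc) (liftS σ) A ⟩
    subF (λ x → shiftT (σ x)) A          ≡⟨ subF-cong (λ x → renT≡subT suc (σ x)) A ⟩
    subF (σ ⨾ renS suc) A                ≡⟨ sym (subF-comp σ (renS suc) A) ⟩
    subF (renS suc) (subF σ A)           ≡⟨ sym (renF≡subF suc (subF σ A)) ⟩
    renF suc (subF σ A)                  ∎
    where open ≡-Reasoning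

  liftS-inst : ∀ σ t A → subF (liftS σ) A [ t ] ≡ subF (t ∷ₛ σ) A
  liftS-inst σ t A = trans (subF-comp (liftS σ) (σ₀ t) A) (subF-cong pointwise A)
    where
    pointwise : liftS σ ⨾ σ₀ t ≗ t ∷ₛ σ
    pointwise zero    = refl
    pointwise (suc x) = shiftT-inst t (σ x)

  subF-inst : ∀ σ t A → subF σ (A [ t ]) ≡ subF (liftS σ) A [ subT σ t ]
  subF-inst σ t A = begin
    subF σ (A [ t ])                     ≡⟨ subF-comp (σ₀ t) σ A ⟩
    subF (σ₀ t ⨾ σ) A                    ≡⟨ subF-cong pointwise A ⟩
    subF (subT σ t ∷ₛ σ) A               ≡⟨ sym (liftS-inst σ (subT σ t) A) ⟩
    subF (liftS σ) A [ subT σ t ]        ∎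
    where
    open ≡-Reasoning
    pointwise : σ₀ t ⨾ σ ≗ subT σ t ∷ₛ σ
    pointwise zero    = refl
    pointwise (suc x) = refl

  liftSAt : ℕ → Subst → Subst
  liftSAt n σ x with x ≟ n
  ... | yes _ = var 0
  ... | no  _ = shiftT (σ x)

  subF-liftSAt : ∀ {n} σ {F} → WfF (suc n) F → subF (liftSAt n σ) (F [ var n ]) ≡ subF (liftS σ) F
  subF-liftSAt {n} σ {F} w = trans (subF-comp (σ₀ (var n)) (liftSAt n σ) F) (subF-agree w agree)
    where
    agree : Agree (suc n) (σ₀ (var n) ⨾ liftSAt n σ) (liftS σ)
    agree zero _ with n ≟ n
    ... | yes _  = refl
    ... | no n≢n = ⊥-elim (n≢n refl)
    agree (suc y) (s≤s y<n) with y ≟ n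
    ... | yes refl = ⊥-elim (<-irrefl refl y<n)
    ... | no  _    = refl

module _ {S : Signature} where

  ⊢-weaken : ∀ {Γ Δ} {A : Formula S} → Γ ⊆ Δ → Γ ⊢ A → Δ ⊢ A
  ⊢-weaken Γ⊆Δ (ax A∈Γ)   = ax (Γ⊆Δ A∈Γ)
  ⊢-weaken Γ⊆Δ ⊤I         = ⊤I
  ⊢-weaken Γ⊆Δ (⊥E d)     = ⊥E (⊢-weaken Γ⊆Δ d)
  ⊢-weaken Γ⊆Δ (⇒I d)     = ⇒I (⊢-weaken (∷⁺ʳ _ Γ⊆Δ) d)
  ⊢-weaken Γ⊆Δ (⇒E d e)   = ⇒E (⊢-weaken Γ⊆Δ d) (⊢-weaken Γ⊆Δ e)
  ⊢-weaken Γ⊆Δ (∧I d e)   = ∧I (⊢-weaken Γ⊆Δ d) (⊢-weaken Γ⊆Δ e)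
  ⊢-weaken Γ⊆Δ (∧E₁ d)    = ∧E₁ (⊢-weaken Γ⊆Δ d)
  ⊢-weaken Γ⊆Δ (∧E₂ d)    = ∧E₂ (⊢-weaken Γ⊆Δ d)
  ⊢-weaken Γ⊆Δ (∨I₁ d)    = ∨I₁ (⊢-weaken Γ⊆Δ d)
  ⊢-weaken Γ⊆Δ (∨I₂ d)    = ∨I₂ (⊢-weaken Γ⊆Δ d)
  ⊢-weaken Γ⊆Δ (∨E d e f) = ∨E (⊢-weaken Γ⊆Δ d) (⊢-weaken (∷⁺ʳ _ Γ⊆Δ) e) (⊢-weaken (∷⁺ʳ _ Γ⊆Δ) f)
  ⊢-weaken Γ⊆Δ (∀I d)     = ∀I (⊢-weaken (map⁺ shift Γ⊆Δ) d)
  ⊢-weaken Γ⊆Δ (∀E d t)   = ∀E (⊢-weaken Γ⊆Δ d) t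
  ⊢-weaken Γ⊆Δ (∃I t d)   = ∃I t (⊢-weaken Γ⊆Δ d)
  ⊢-weaken Γ⊆Δ (∃E d e)   = ∃E (⊢-weaken Γ⊆Δ d) (⊢-weaken (∷⁺ʳ _ (map⁺ shift Γ⊆Δ)) e)

  #0 : ∀ {Γ} {A : Formula S} → A ∷ Γ ⊢ A
  #0 = ax (here refl)

  #1 : ∀ {Γ} {A B : Formula S} → B ∷ A ∷ Γ ⊢ A
  #1 = ax (there (here refl))

  #2 : ∀ {Γ} {A B C : Formula S} → C ∷ B ∷ A ∷ Γ ⊢ A
  #2 = ax (there (there (here refl)))

  #3 : ∀ {Γ} {A B C D : Formula S} → D ∷ C ∷ B ∷ A ∷ Γ ⊢ A
  #3 = ax (there (there (there (here refl))))

  ∀E-shift₀ : ∀ {Γ} {A : Formula S} → Γ ⊢ shift (∀′ A) → Γ ⊢ A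
  ∀E-shift₀ {Γ} {A} d = subst (Γ ⊢_) (shift↑-inst-var₀ A) (∀E d (var 0))

module _ {S : Signature} {𝒯 : Formula S → Set} where

  ⊢⇒⊩ : ∀ {A} → [] ⊢ A → 𝒯 ⊩ A
  ⊢⇒⊩ d = [] , [] , d

  ⊩-axiom : ∀ {A} → 𝒯 A → 𝒯 ⊩ A
  ⊩-axiom 𝒯A = _ ∷ [] , 𝒯A ∷ [] , #0

  ⊩-mp : ∀ {A B} → 𝒯 ⊩ A ⇒′ B → 𝒯 ⊩ A → 𝒯 ⊩ B
  ⊩-mp (Γ , 𝒯Γ , d) (Δ , 𝒯Δ , e) =
    Γ ++ Δ , ++⁺ 𝒯Γ 𝒯Δ , ⇒E (⊢-weaken (xs⊆xs++ys Γ Δ) d) (⊢-weaken (xs⊆ys++xs Δ Γ) e)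

  ⊩-mp₂ : ∀ {A B C} → 𝒯 ⊩ A ⇒′ B ⇒′ C → 𝒯 ⊩ A → 𝒯 ⊩ B → 𝒯 ⊩ C
  ⊩-mp₂ d e f = ⊩-mp (⊩-mp d e) f

  ⊩-trans : ∀ {A B C} → 𝒯 ⊩ A ⇒′ B → 𝒯 ⊩ B ⇒′ C → 𝒯 ⊩ A ⇒′ C
  ⊩-trans = ⊩-mp₂ (⊢⇒⊩ (⇒I (⇒I (⇒I (⇒E #1 (⇒E #2 #0))))))

  ⊩-discharge₂ : ∀ {A B C} → 𝒯 ⊩ A ⇒′ B ⇒′ C → 𝒯 ⊩ B → 𝒯 ⊩ A ⇒′ C
  ⊩-discharge₂ = ⊩-mp₂ (⊢⇒⊩ (⇒I (⇒I (⇒I (⇒E (⇒E #2 #0) #1)))))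

  ⊩-⇒-mono : ∀ {A A′ B B′} → 𝒯 ⊩ A′ ⇒′ A → 𝒯 ⊩ B ⇒′ B′ → 𝒯 ⊩ (A ⇒′ B) ⇒′ A′ ⇒′ B′
  ⊩-⇒-mono = ⊩-mp₂ (⊢⇒⊩ (⇒I (⇒I (⇒I (⇒I (⇒E #2 (⇒E #1 (⇒E #3 #0))))))))

  ⊩-∧-mono : ∀ {A A′ B B′} → 𝒯 ⊩ A ⇒′ A′ → 𝒯 ⊩ B ⇒′ B′ → 𝒯 ⊩ A ∧′ B ⇒′ A′ ∧′ B′
  ⊩-∧-mono = ⊩-mp₂ (⊢⇒⊩ (⇒I (⇒I (⇒I (∧I (⇒E #2 (∧E₁ #0)) (⇒E #1 (∧E₂ #0)))))))

  ⊩-∨-mono : ∀ {A A′ B B′} → 𝒯 ⊩ A ⇒′ A′ → 𝒯 ⊩ B ⇒′ B′ → 𝒯 ⊩ A ∨′ B ⇒′ A′ ∨′ B′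
  ⊩-∨-mono = ⊩-mp₂ (⊢⇒⊩ (⇒I (⇒I (⇒I (∨E #0 (∨I₁ (⇒E #3 #0)) (∨I₂ (⇒E #2 #0)))))))

  ⊩-∀I : (∀ C → 𝒯 C → Closed C) → ∀ {A} → 𝒯 ⊩ A → 𝒯 ⊩ ∀′ A
  ⊩-∀I 𝒯-closed {A} (Γ , 𝒯Γ , d) = Γ , 𝒯Γ , ∀I (subst (_⊢ A) (sym (map-shift-closed 𝒯Γ)) d)
    where
    map-shift-closed : ∀ {Γ} → All 𝒯 Γ → map shift Γ ≡ Γ
    map-shift-closed []          = refl
    map-shift-closed (𝒯C ∷ 𝒯Γ) = cong₂ _∷_ (shift-closed (𝒯-closed _ 𝒯C)) (map-shift-closed 𝒯Γ)

module _ {S : Signature} {𝔅 : TVA} (𝕄 : Structure S 𝔅) where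
  open TVA 𝔅
  open Semantics 𝕄
  open IsEquivalence ≈-equiv renaming (refl to ≈-refl; trans to ≈-trans)

  mutual
    Den-unique : ∀ {φ A a b} → Den φ A a → Den φ A b → a ≈ b
    Den-unique (atom P ts)  (atom .P .ts) = ≈-refl
    Den-unique ⊤′           ⊤′            = ≈-refl
    Den-unique ⊥′           ⊥′            = ≈-refl
    Den-unique (d ⇒′ e)     (d′ ⇒′ e′)    = ⇒̃-cong (Den-unique d d′) (Den-unique e e′)
    Den-unique (d ∧′ e)     (d′ ∧′ e′)    = ∧̃-cong (Den-unique d d′) (Den-unique e e′)
    Den-unique (d ∨′ e)     (d′ ∨′ e′)    = ∨̃-cong (Den-unique d d′) (Den-unique e e′)
    Den-unique (∀′ f d p)   (∀′ g d′ p′)  = ∀̃-ext (Img-⊆ d d′) (Img-⊆ d′ d) p p′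
    Den-unique (∃′ f d p)   (∃′ g d′ p′)  = ∃̃-ext (Img-⊆ d d′) (Img-⊆ d′ d) p p′

    Img-⊆ : ∀ {φ A f g} → (∀ e → Den (φ ▷ e) A (f e)) → (∀ e → Den (φ ▷ e) A (g e)) →
            ∀ b → Img f b → Img g b
    Img-⊆ d d′ b (e , b≈fe) = e , ≈-trans b≈fe (Den-unique (d e) (d′ e))

module Lindenbaum {S : Signature} (𝒯 : Formula S → Set) (𝒯-closed : ∀ C → 𝒯 C → Closed C) where

  -- Closing under substitution makes ∀-introduction admissible (see ∀-intro) without
  -- a substitution lemma for derivations.
  Thm : Formula S → Set
  Thm A = ∀ σ → 𝒯 ⊩ subF σ A

  Thm-mp : ∀ {A B} → Thm (A ⇒′ B) → Thm A → Thm B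
  Thm-mp d e σ = ⊩-mp (d σ) (e σ)

  Thm-trans : ∀ {A B C} → Thm (A ⇒′ B) → Thm (B ⇒′ C) → Thm (A ⇒′ C)
  Thm-trans d e σ = ⊩-trans (d σ) (e σ)

  Thm-id : ∀ {A} → Thm (A ⇒′ A)
  Thm-id σ = ⊢⇒⊩ (⇒I #0)

  infix 4 _≃_
  _≃_ : Formula S → Formula S → Set
  A ≃ B = Thm (A ⇒′ B) × Thm (B ⇒′ A)

  ≃-refl : ∀ {A} → A ≃ A
  ≃-refl = Thm-id , Thm-id

  ≃-reflexive : ∀ {A B} → A ≡ B → A ≃ B
  ≃-reflexive refl = ≃-refl

  ≃-sym : ∀ {A B} → A ≃ B → B ≃ A
  ≃-sym (A⇒B , B⇒A) = B⇒A , A⇒B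

  ≃-trans : ∀ {A B C} → A ≃ B → B ≃ C → A ≃ C
  ≃-trans (A⇒B , B⇒A) (B⇒C , C⇒B) = Thm-trans A⇒B B⇒C , Thm-trans C⇒B B⇒A

  Thm-resp : ∀ {A B} → A ≃ B → Thm A → Thm B
  Thm-resp (A⇒B , _) = Thm-mp A⇒B

  ⇒′-cong : ∀ {A A′ B B′} → A ≃ A′ → B ≃ B′ → (A ⇒′ B) ≃ (A′ ⇒′ B′)
  ⇒′-cong (A⇒A′ , A′⇒A) (B⇒B′ , B′⇒B) =
    (λ σ → ⊩-⇒-mono (A′⇒A σ) (B⇒B′ σ)) , (λ σ → ⊩-⇒-mono (A⇒A′ σ) (B′⇒B σ))

  ∧′-cong : ∀ {A A′ B B′} → A ≃ A′ → B ≃ B′ → (A ∧′ B) ≃ (A′ ∧′ B′)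
  ∧′-cong (A⇒A′ , A′⇒A) (B⇒B′ , B′⇒B) =
    (λ σ → ⊩-∧-mono (A⇒A′ σ) (B⇒B′ σ)) , (λ σ → ⊩-∧-mono (A′⇒A σ) (B′⇒B σ))

  ∨′-cong : ∀ {A A′ B B′} → A ≃ A′ → B ≃ B′ → (A ∨′ B) ≃ (A′ ∨′ B′)
  ∨′-cong (A⇒A′ , A′⇒A) (B⇒B′ , B′⇒B) =
    (λ σ → ⊩-∨-mono (A⇒A′ σ) (B⇒B′ σ)) , (λ σ → ⊩-∨-mono (A′⇒A σ) (B′⇒B σ))

  ∀-elim : ∀ F t → Thm (∀′ F ⇒′ F [ t ])
  ∀-elim F t σ = subst (λ G → 𝒯 ⊩ ∀′ (subF (liftS σ) F) ⇒′ G) (sym (subF-inst σ t F))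
                       (⊢⇒⊩ (⇒I (∀E #0 (subT σ t))))

  ∃-intro : ∀ F t → Thm (F [ t ] ⇒′ ∃′ F)
  ∃-intro F t σ = subst (λ G → 𝒯 ⊩ G ⇒′ ∃′ (subF (liftS σ) F)) (sym (subF-inst σ t F))
                        (⊢⇒⊩ (⇒I (∃I (subT σ t) #0)))

  ∀-intro : ∀ {n F} → WfF (suc n) F → Thm (F [ var n ]) → Thm (∀′ F)
  ∀-intro {n} w F[n] σ = ⊩-∀I 𝒯-closed (subst (𝒯 ⊩_) (subF-liftSAt σ w) (F[n] (liftSAt n σ)))

  ∀-shift-⇒ : ∀ A F → Thm (∀′ (shift A ⇒′ F) ⇒′ A ⇒′ ∀′ F)
  ∀-shift-⇒ A F σ =
    subst (λ G → 𝒯 ⊩ ∀′ (G ⇒′ subF (liftS σ) F) ⇒′ subF σ A ⇒′ ∀′ (subF (liftS σ) F))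
          (sym (subF-liftS-shift σ A))
          (⊢⇒⊩ (⇒I (⇒I (∀I (⇒E (∀E-shift₀ #1) #0)))))

  ∃-⇒-shift : ∀ A F → Thm (∃′ F ⇒′ ∀′ (F ⇒′ shift A) ⇒′ A)
  ∃-⇒-shift A F σ =
    subst (λ G → 𝒯 ⊩ ∃′ (subF (liftS σ) F) ⇒′ ∀′ (subF (liftS σ) F ⇒′ G) ⇒′ subF σ A)
          (sym (subF-liftS-shift σ A))
          (⊢⇒⊩ (⇒I (⇒I (∃E #1 (⇒E (∀E-shift₀ #1) #0)))))

  ⇒∀-intro : ∀ {n A F} → WfF (suc n) (shift A ⇒′ F) → Thm (A ⇒′ F [ var n ]) → Thm (A ⇒′ ∀′ F)
  ⇒∀-intro {n} {A} {F} w A⇒F[n] =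
    Thm-mp (∀-shift-⇒ A F)
      (∀-intro w (subst (λ B → Thm (B ⇒′ F [ var n ])) (sym (shift-inst A (var n))) A⇒F[n]))

  ∃⇒-elim : ∀ {n F C} → WfF (suc n) (F ⇒′ shift C) → Thm (F [ var n ] ⇒′ C) → Thm (∃′ F ⇒′ C)
  ∃⇒-elim {n} {F} {C} w F[n]⇒C σ =
    ⊩-discharge₂ (∃-⇒-shift C F σ)
      (∀-intro w (subst (λ B → Thm (F [ var n ] ⇒′ B)) (sym (shift-inst C (var n))) F[n]⇒C) σ)

  InstanceOf : Formula S → Subset (Formula S)
  InstanceOf F B = Σ (Term S) λ t → B ≃ F [ t ]

  InstanceSet : Subset (Formula S) → Set
  InstanceSet X = Σ (Formula S) λ F → (∀ B → X B → InstanceOf F B) × (∀ B → InstanceOf F B → X B)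

  InstanceSet-ext : ∀ {X X′} → (∀ B → X B → X′ B) → (∀ B → X′ B → X B) →
                    InstanceSet X → InstanceSet X′
  InstanceSet-ext X⊆X′ X′⊆X (F , X⊆F , F⊆X) =
    F , (λ B X′B → X⊆F B (X′⊆X B X′B)) , (λ B FB → X⊆X′ B (F⊆X B FB))

  ∀-antitone : ∀ {X X′} → (∀ B → X′ B → X B) → (p : InstanceSet X) (p′ : InstanceSet X′) →
               Thm (∀′ (proj₁ p) ⇒′ ∀′ (proj₁ p′))
  ∀-antitone X′⊆X (F , X⊆F , _) (G , _ , G⊆X′) with fresh (shift (∀′ F) ⇒′ G)
  ... | n , w with X⊆F _ (X′⊆X _ (G⊆X′ _ (var n , ≃-refl)))
  ... | s , (_ , F[s]⇒G[n]) = ⇒∀-intro w (Thm-trans (∀-elim F s) F[s]⇒G[n])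

  ∃-monotone : ∀ {X X′} → (∀ B → X B → X′ B) → (p : InstanceSet X) (p′ : InstanceSet X′) →
               Thm (∃′ (proj₁ p) ⇒′ ∃′ (proj₁ p′))
  ∃-monotone X⊆X′ (F , _ , F⊆X) (G , X′⊆G , _) with fresh (F ⇒′ shift (∃′ G))
  ... | n , w with X′⊆G _ (X⊆X′ _ (F⊆X _ (var n , ≃-refl)))
  ... | s , (F[n]⇒G[s] , _) = ∃⇒-elim w (Thm-trans F[n]⇒G[s] (∃-intro G s))

  _⇒′set_ : Formula S → Subset (Formula S) → Subset (Formula S)
  (A ⇒′set X) B = Σ (Formula S) λ E → X E × (B ≃ (A ⇒′ E))

  _set⇒′_ : Subset (Formula S) → Formula S → Subset (Formula S)
  (X set⇒′ A) B = Σ (Formula S) λ E → X E × (B ≃ (E ⇒′ A))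

  ⇒′set-instanceSet : ∀ A X → InstanceSet X → InstanceSet (A ⇒′set X)
  ⇒′set-instanceSet A X (F , X⊆F , F⊆X) = shift A ⇒′ F , ⊆shiftA⇒F , shiftA⇒F⊆
    where
    ⊆shiftA⇒F : ∀ B → (A ⇒′set X) B → InstanceOf (shift A ⇒′ F) B
    ⊆shiftA⇒F B (E , XE , B≃A⇒E) =
      let t , E≃F[t] = X⊆F E XE
      in t , ≃-trans B≃A⇒E (⇒′-cong (≃-reflexive (sym (shift-inst A t))) E≃F[t])
    shiftA⇒F⊆ : ∀ B → InstanceOf (shift A ⇒′ F) B → (A ⇒′set X) B
    shiftA⇒F⊆ B (t , B≃) =
      F [ t ] , F⊆X _ (t , ≃-refl) , ≃-trans B≃ (⇒′-cong (≃-reflexive (shift-inst A t)) ≃-refl)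

  set⇒′-instanceSet : ∀ A X → InstanceSet X → InstanceSet (X set⇒′ A)
  set⇒′-instanceSet A X (F , X⊆F , F⊆X) = F ⇒′ shift A , ⊆F⇒shiftA , F⇒shiftA⊆
    where
    ⊆F⇒shiftA : ∀ B → (X set⇒′ A) B → InstanceOf (F ⇒′ shift A) B
    ⊆F⇒shiftA B (E , XE , B≃E⇒A) =
      let t , E≃F[t] = X⊆F E XE
      in t , ≃-trans B≃E⇒A (⇒′-cong E≃F[t] (≃-reflexive (sym (shift-inst A t))))
    F⇒shiftA⊆ : ∀ B → InstanceOf (F ⇒′ shift A) B → (X set⇒′ A) B
    F⇒shiftA⊆ B (t , B≃) =
      F [ t ] , F⊆X _ (t , ≃-refl) , ≃-trans B≃ (⇒′-cong ≃-refl (≃-reflexive (shift-inst A t)))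

  ∀-instanceSet : ∀ {X} (p : InstanceSet X) → (∀ B → X B → Thm B) → Thm (∀′ (proj₁ p))
  ∀-instanceSet (F , _ , F⊆X) X⊆Thm =
    let n , w = fresh F in ∀-intro w (X⊆Thm _ (F⊆X _ (var n , ≃-refl)))

  ∀-instanceSet-elim : ∀ {X A} (p : InstanceSet X) → X A → Thm (∀′ (proj₁ p) ⇒′ A)
  ∀-instanceSet-elim (F , X⊆F , _) XA =
    let t , (_ , F[t]⇒A) = X⊆F _ XA in Thm-trans (∀-elim F t) F[t]⇒A

  ∃-instanceSet-intro : ∀ {X A} (p : InstanceSet X) → X A → Thm (A ⇒′ ∃′ (proj₁ p))
  ∃-instanceSet-intro (F , X⊆F , _) XA =
    let t , (A⇒F[t] , _) = X⊆F _ XA in Thm-trans A⇒F[t] (∃-intro F t)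

  algebra : TVA
  algebra = record
    { B       = Formula S
    ; _≈_     = _≃_
    ; ≈-equiv = record { refl = ≃-refl ; sym = ≃-sym ; trans = ≃-trans }
    ; B⁺      = Thm
    ; 𝒜       = InstanceSet
    ; 𝓔       = InstanceSet
    ; ⊤̃       = ⊤′
    ; ⊥̃       = ⊥′
    ; _⇒̃_     = _⇒′_
    ; _∧̃_     = _∧′_
    ; _∨̃_     = _∨′_
    ; ∀̃       = λ _ p → ∀′ (proj₁ p)
    ; ∃̃       = λ _ p → ∃′ (proj₁ p)
    ; B⁺-resp = Thm-resp
    ; ⇒̃-cong  = ⇒′-cong
    ; ∧̃-cong  = ∧′-cong
    ; ∨̃-cong  = ∨′-cong
    ; 𝒜-ext   = InstanceSet-ext
    ; 𝓔-ext   = InstanceSet-ext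
    ; ∀̃-ext   = λ X⊆X′ X′⊆X p p′ → ∀-antitone X′⊆X p p′ , ∀-antitone X⊆X′ p′ p
    ; ∃̃-ext   = λ X⊆X′ X′⊆X p p′ → ∃-monotone X⊆X′ p p′ , ∃-monotone X′⊆X p′ p
    ; ax1     = Thm-mp
    ; ax2     = λ _ _ σ → ⊢⇒⊩ (⇒I (⇒I #1))
    ; ax3     = λ _ _ _ σ → ⊢⇒⊩ (⇒I (⇒I (⇒I (⇒E (⇒E #2 #0) (⇒E #1 #0)))))
    ; ax4     = λ σ → ⊢⇒⊩ ⊤I
    ; ax5     = λ _ σ → ⊢⇒⊩ (⇒I (⊥E #0))
    ; ax6     = λ _ _ σ → ⊢⇒⊩ (⇒I (⇒I (∧I #1 #0)))
    ; ax7     = λ _ _ σ → ⊢⇒⊩ (⇒I (∧E₁ #0))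
    ; ax8     = λ _ _ σ → ⊢⇒⊩ (⇒I (∧E₂ #0))
    ; ax9     = λ _ _ σ → ⊢⇒⊩ (⇒I (∨I₁ #0))
    ; ax10    = λ _ _ σ → ⊢⇒⊩ (⇒I (∨I₂ #0))
    ; ax11    = λ _ _ _ σ → ⊢⇒⊩ (⇒I (⇒I (⇒I (∨E #2 (⇒E #2 #0) (⇒E #1 #0)))))
    ; ax12a   = ⇒′set-instanceSet
    ; ax12b   = set⇒′-instanceSet
    ; ax13    = λ _ p → ∀-instanceSet p
    ; ax14    = λ A _ p → ∀-shift-⇒ A (proj₁ p)
    ; ax15    = λ _ _ p → ∀-instanceSet-elim p
    ; ax16    = λ _ _ p → ∃-instanceSet-intro p
    ; ax17    = λ A _ p → ∃-⇒-shift A (proj₁ p)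
    }

  termStructure : Structure S algebra
  termStructure = record { M = Term S ; funI = app ; predI = atom }

  open Semantics termStructure

  mutual
    ⟦⟧t≡subT : ∀ φ t → ⟦ t ⟧t φ ≡ subT φ t
    ⟦⟧t≡subT φ (var x)    = refl
    ⟦⟧t≡subT φ (app f ts) = cong (app f) (⟦⟧ts≡subTs φ ts)

    ⟦⟧ts≡subTs : ∀ {n} φ (ts : Vec (Term S) n) → ⟦ ts ⟧ts φ ≡ subTs φ ts
    ⟦⟧ts≡subTs φ []       = refl
    ⟦⟧ts≡subTs φ (t ∷ ts) = cong₂ _∷_ (⟦⟧t≡subT φ t) (⟦⟧ts≡subTs φ ts)

  ▷-inst : ∀ φ t A → subF (liftS φ) A [ t ] ≡ subF (φ ▷ t) A
  ▷-inst φ t A = trans (liftS-inst φ t A) (subF-cong pointwise A)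
    where
    pointwise : t ∷ₛ φ ≗ φ ▷ t
    pointwise zero    = refl
    pointwise (suc x) = refl

  Img-instanceSet : ∀ φ A → InstanceSet (Img λ t → subF (φ ▷ t) A)
  Img-instanceSet φ A = subF (liftS φ) A , ⊆inst , inst⊆
    where
    ⊆inst : ∀ B → Img (λ t → subF (φ ▷ t) A) B → InstanceOf (subF (liftS φ) A) B
    ⊆inst B (t , B≃) = t , ≃-trans B≃ (≃-reflexive (sym (▷-inst φ t A)))
    inst⊆ : ∀ B → InstanceOf (subF (liftS φ) A) B → Img (λ t → subF (φ ▷ t) A) B
    inst⊆ B (t , B≃) = t , ≃-trans B≃ (≃-reflexive (▷-inst φ t A))

  Den-subF : ∀ φ A → Den φ A (subF φ A)
  Den-subF φ (atom P ts) = subst (Den φ (atom P ts)) (cong (atom P) (⟦⟧ts≡subTs φ ts)) (atom P ts)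
  Den-subF φ ⊤′          = ⊤′
  Den-subF φ ⊥′          = ⊥′
  Den-subF φ (A ⇒′ C)    = Den-subF φ A ⇒′ Den-subF φ C
  Den-subF φ (A ∧′ C)    = Den-subF φ A ∧′ Den-subF φ C
  Den-subF φ (A ∨′ C)    = Den-subF φ A ∨′ Den-subF φ C
  Den-subF φ (∀′ A)      = ∀′ _ (λ t → Den-subF (φ ▷ t) A) (Img-instanceSet φ A)
  Den-subF φ (∃′ A)      = ∃′ _ (λ t → Den-subF (φ ▷ t) A) (Img-instanceSet φ A)

  termStructure-isModel : IsModelOf 𝒯
  termStructure-isModel C 𝒯C φ = subF φ C , Den-subF φ C , instances
    where
    instances : Thm (subF φ C)
    instances σ =
      subst (𝒯 ⊩_) (sym (trans (subF-comp φ σ C) (subF-closed (𝒯-closed C 𝒯C)))) (⊩-axiom 𝒯C)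

  valid⇒⊩ : ∀ A → Valid A → 𝒯 ⊩ A
  valid⇒⊩ A valid =
    let b , Den-b , Thm-b = valid var
        Thm-A = Thm-resp (Den-unique termStructure Den-b (Den-subF var A)) Thm-b
    in subst (𝒯 ⊩_) (trans (subF-var (subF var A)) (subF-var A)) (Thm-A var)

mainTheorem6 : (S : Signature) (𝒯 : Formula S → Set) (A : Formula S) →
               (∀ C → 𝒯 C → Closed C) →
               ((𝔅 : TVA) (𝕄 : Structure S 𝔅) →
                  Semantics.IsModelOf 𝕄 𝒯 →
                  Semantics.DefinedEverywhere 𝕄 A →
                  Semantics.Valid 𝕄 A) →
               𝒯 ⊩ A
mainTheorem6 S 𝒯 A 𝒯-closed valid =
  valid⇒⊩ A (valid algebra termStructure termStructure-isModel (λ φ → subF φ A , Den-subF φ A))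
  where open Lindenbaum 𝒯 𝒯-closed
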